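{- Let $G$ be a digraph, $s_1,t_1,\ldots,s_k,t_k$ distinct vertices of $G$, and $L$ a minimum linkage for $(G,s_1,t_1,\ldots,s_k,t_k)$. Let $\ell\ge 3$, let $C$ be a clique of $G$, let $Q'$ be a subpath of some member of $L$, and let $Q$ be a subpath of $Q'$ with $|C\cap V(Q)|\ge\ell$. Let $v\in C\setminus V(L)$ be adjacent from each of the last $\ell$ vertices of $Q$ in $C$. Then $v$ is adjacent from each of the last $\ell$ vertices of $Q'$ in $C$.
   Context: Digraphs are finite, without loops or parallel edges; paths are directed. "$v$ is adjacent from $u$" means $uv$ is an edge of $G$. A clique is a set $C\subseteq V(G)$ such that every two distinct vertices of $C$ are joined by an edge in at least one direction. A linkage is a family $(P_1,\ldots,P_k)$ of pairwise vertex-disjoint paths, with $V(L)$ the union of their vertex sets; it is for $(G,s_1,t_1,\ldots,s_k,t_k)$ if $P_i$ is from $s_i$ to $t_i$; it is minimum if there is no linkage $(P_1',\ldots,P_k')$ with $P_i'$ having the same first and last vertices as $P_i$ for each $i$ and using fewer vertices in total. "The last $\ell$ vertices of $Q$ in $C$" means the last $\ell$ vertices of $Q$ belonging to $C$, in the order of $Q$. -}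

module Defs where

open import Data.Nat using (ℕ; _≤_; _+_; _∸_)
open import Data.Fin using (Fin)
open import Data.Fin.Subset using (Subset) renaming (_∈_ to _∈ₛ_)
open import Data.Fin.Subset.Properties using (_∈?_)
open import Data.List using (List; []; _∷_; _++_; length; filter; drop; head; last; map; allFin)
open import Data.Nat.ListAction using (sum)
open import Data.List.Membership.Propositional using (_∈_; _∉_)
open import Data.List.Relation.Unary.All using (All)
open import Data.List.Relation.Unary.Unique.Propositional using (Unique)
open import Data.List.Relation.Unary.Linked using (Linked)
open import Data.Maybe using (just)
open import Data.Product using (Σ; ∃; _×_; _,_)
open import Data.Sum using (_⊎_)
open import Relation.Binary.PropositionalEquality using (_≡_; _≢_)
open import Relation.Nullary using (¬_)
open import Level using (0ℓ)

record Digraph : Set₁ where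
  field
    n     : ℕ
    E     : Fin n → Fin n → Set
    loopless : ∀ v → ¬ E v v
open Digraph public

Vertex : Digraph → Set
Vertex G = Fin (n G)

IsPath : (G : Digraph) → List (Vertex G) → Set
IsPath G p = (p ≢ []) × Unique p × Linked (E G) p

IsPathFromTo : (G : Digraph) → Vertex G → Vertex G → List (Vertex G) → Set
IsPathFromTo G s t p = IsPath G p × head p ≡ just s × last p ≡ just t

IsSubpath : ∀ {A : Set} → List A → List A → Set
IsSubpath {A} q p = Σ (List A) λ pre → Σ (List A) λ suf → p ≡ pre ++ q ++ suf

IsClique : (G : Digraph) → Subset (n G) → Set
IsClique G C = ∀ u w → u ∈ₛ C → w ∈ₛ C → u ≢ w → E G u w ⊎ E G w u

AllDistinct : ∀ {m k} → (Fin k → Fin m) → (Fin k → Fin m) → Set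
AllDistinct s t = (∀ i j → s i ≡ s j → i ≡ j) × (∀ i j → t i ≡ t j → i ≡ j) × (∀ i j → s i ≢ t j)

Linkage : (G : Digraph) → (k : ℕ) → (Fin k → List (Vertex G)) → Set
Linkage G k P = (∀ i → IsPath G (P i)) × (∀ i j → i ≢ j → ∀ x → x ∈ P i → x ∉ P j)

LinkageFor : (G : Digraph) → (k : ℕ) → (s t : Fin k → Vertex G) → (Fin k → List (Vertex G)) → Set
LinkageFor G k s t P = Linkage G k P × (∀ i → IsPathFromTo G (s i) (t i) (P i))

-- total number of vertices used by a linkage (paths are disjoint).
size : ∀ {A : Set} {k} → (Fin k → List A) → ℕ
size {k = k} P = sum (map (λ i → length (P i)) (allFin k))

IsMinimumLinkageFor : (G : Digraph) → (k : ℕ) → (s t : Fin k → Vertex G) → (Fin k → List (Vertex G)) → Set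
IsMinimumLinkageFor G k s t P =
  LinkageFor G k s t P × (∀ P′ → LinkageFor G k s t P′ → size P ≤ size P′)

inC : ∀ {m} → Subset m → List (Fin m) → List (Fin m)
inC C q = filter (_∈? C) q

lastInC : ∀ {m} → ℕ → Subset m → List (Fin m) → List (Fin m)
lastInC ℓ C q = drop (length (inC C q) ∸ ℓ) (inC C q)

-- Among the last ℓ clique vertices of Q′, those in Q are adjacent to v by hypothesis; any
-- other one, w, comes after Q.  Were w not adjacent to v, the clique would give the edge
-- v → w.  The first u of the last ℓ clique vertices of Q is adjacent to v and lies at least
-- ℓ − 1 ≥ 2 steps before w, so rerouting u → v → w shortens the path, contradicting the
-- minimality of the linkage.
module Submission where

open import Defs
open import Data.Nat using (ℕ; zero; suc; _+_; _≤_; _<_; _∸_; z≤n; s≤s; s≤s⁻¹)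
open import Data.Nat.Properties
  using (≤-trans; <⇒≤; <⇒≱; ≤-reflexive; +-∸-assoc; m∸[m∸n]≡n; ∸-monoˡ-≤; +-monoˡ-≤; +-mono-≤; +-mono-<-≤; +-mono-≤-<; m≤m+n; m≤n+m)
open import Data.Nat.ListAction using (sum)
open import Data.Fin using (Fin; _≟_)
open import Data.Fin.Subset using (Subset) renaming (_∈_ to _∈ₛ_)
open import Data.Fin.Subset.Properties using (_∈?_)
open import Data.List using (List; []; _∷_; _++_; length; filter; drop; head; last; map; allFin)
open import Data.List.Properties using (++-monoid; ++-conicalʳ; length-++; length-drop; filter-++; length-filter)
open import Data.List.Membership.Propositional using (_∈_; _∉_)
open import Data.List.Membership.Propositional.Properties using (∈-++⁺ˡ; ∈-++⁺ʳ; ∈-++⁻; ∈-filter⁻; ∈-∃++; ∈-allFin)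
open import Data.List.Relation.Unary.All as All using (All; _∷_)
open import Data.List.Relation.Unary.All.Properties using (++⁻ʳ)
open import Data.List.Relation.Unary.Any using (here; there)
open import Data.List.Relation.Unary.Unique.Propositional using (Unique; _∷_)
open import Data.List.Relation.Unary.Linked using (Linked; []; [-]; _∷_)
open import Data.Maybe using (just)
open import Data.Vec.Functional using (updateAt)
open import Data.Vec.Functional.Properties using (updateAt-updates; updateAt-minimal)
open import Data.Product using (Σ; _×_; _,_; proj₁; proj₂)
open import Data.Sum using (_⊎_; inj₁; inj₂; map₁; map₂)
open import Data.Empty using (⊥; ⊥-elim)
open import Function using (const; _∘_)
open import Relation.Nullary using (¬_; yes; no)
open import Relation.Unary using (Pred; Decidable)
open import Relation.Binary using (Rel)
open import Relation.Binary.PropositionalEquality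
  using (_≡_; _≢_; refl; sym; trans; cong; subst; module ≡-Reasoning)
open import Tactic.MonoidSolver using (solve)

module _ {A : Set} where

  lastN : ℕ → List A → List A
  lastN ℓ xs = drop (length xs ∸ ℓ) xs

  length-lastN : ∀ {ℓ} (xs : List A) → ℓ ≤ length xs → length (lastN ℓ xs) ≡ ℓ
  length-lastN {ℓ} xs ℓ≤ = trans (length-drop (length xs ∸ ℓ) xs) (m∸[m∸n]≡n ℓ≤)

  lastN-∷ : ∀ {ℓ} x (xs : List A) → ℓ ≤ length xs → lastN ℓ (x ∷ xs) ≡ lastN ℓ xs
  lastN-∷ {ℓ} x xs ℓ≤ = cong (λ m → drop m (x ∷ xs)) (+-∸-assoc 1 ℓ≤)

  lastN-++ : ∀ {ℓ} (xs ys : List A) → ℓ ≤ length ys → lastN ℓ (xs ++ ys) ≡ lastN ℓ ys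
  lastN-++ []       ys ℓ≤ = refl
  lastN-++ {ℓ} (x ∷ xs) ys ℓ≤ = trans (lastN-∷ x (xs ++ ys) ℓ≤′) (lastN-++ xs ys ℓ≤)
    where
    ℓ≤′ : ℓ ≤ length (xs ++ ys)
    ℓ≤′ = ≤-trans ℓ≤ (subst (length ys ≤_) (sym (length-++ xs)) (m≤n+m _ _))

  ∈-drop⁻ : ∀ m {x} (xs : List A) → x ∈ drop m xs → x ∈ xs
  ∈-drop⁻ zero    xs       x∈ = x∈
  ∈-drop⁻ (suc m) (y ∷ xs) x∈ = there (∈-drop⁻ m xs x∈)

  ∈-drop-++⁻ : ∀ {j m x} (ys zs : List A) → j ≤ m → x ∈ drop m (ys ++ zs) → x ∈ drop j ys ⊎ x ∈ zs
  ∈-drop-++⁻ {m = m} []       zs j≤m       x∈ = inj₂ (∈-drop⁻ m zs x∈)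
  ∈-drop-++⁻ {zero} {zero}  (y ∷ ys) zs j≤m x∈ = ∈-++⁻ (y ∷ ys) x∈
  ∈-drop-++⁻ {zero} {suc m} (y ∷ ys) zs j≤m x∈ = map₁ there (∈-drop-++⁻ {m = m} ys zs z≤n x∈)
  ∈-drop-++⁻ {suc j} {suc m} (y ∷ ys) zs j≤m x∈ = ∈-drop-++⁻ ys zs (s≤s⁻¹ j≤m) x∈

  ∈-lastN-++⁻ : ∀ {ℓ x} (xs ys zs : List A) → ℓ ≤ length ys →
                x ∈ lastN ℓ (xs ++ ys ++ zs) → x ∈ lastN ℓ ys ⊎ x ∈ zs
  ∈-lastN-++⁻ {ℓ} {x} xs ys zs ℓ≤ x∈ =
    ∈-drop-++⁻ ys zs (∸-monoˡ-≤ ℓ |ys|≤) (subst (x ∈_) (lastN-++ xs (ys ++ zs) ℓ≤′) x∈)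
    where
    |ys|≤ : length ys ≤ length (ys ++ zs)
    |ys|≤ = subst (length ys ≤_) (sym (length-++ ys)) (m≤m+n _ _)
    ℓ≤′ : ℓ ≤ length (ys ++ zs)
    ℓ≤′ = ≤-trans ℓ≤ |ys|≤

  drop-filter-split : ∀ {p} {P : Pred A p} (P? : Decidable P) j (xs : List A) {y ys} →
                      drop j (filter P? xs) ≡ y ∷ ys →
                      Σ (List A) λ zs₁ → Σ (List A) λ zs₂ → xs ≡ zs₁ ++ y ∷ zs₂ × length ys ≤ length zs₂
  drop-filter-split P? zero    [] ()
  drop-filter-split P? (suc j) [] ()
  drop-filter-split P? j (x ∷ xs) eq with P? x
  drop-filter-split P? zero    (x ∷ xs) refl | yes _ = [] , xs , refl , length-filter P? xs
  drop-filter-split P? (suc j) (x ∷ xs) eq   | yes _ with drop-filter-split P? j xs eq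
  ... | zs₁ , zs₂ , refl , ≤zs₂ = x ∷ zs₁ , zs₂ , refl , ≤zs₂
  drop-filter-split P? j       (x ∷ xs) eq   | no _ with drop-filter-split P? j xs eq
  ... | zs₁ , zs₂ , refl , ≤zs₂ = x ∷ zs₁ , zs₂ , refl , ≤zs₂

  Unique-++⁻ʳ : ∀ (xs : List A) {ys} → Unique (xs ++ ys) → Unique ys
  Unique-++⁻ʳ []       u        = u
  Unique-++⁻ʳ (x ∷ xs) (_ ∷ u) = Unique-++⁻ʳ xs u

  Linked-++⁻ʳ : ∀ {r} {R : Rel A r} (xs : List A) {ys} → Linked R (xs ++ ys) → Linked R ys
  Linked-++⁻ʳ []           l       = l
  Linked-++⁻ʳ (x ∷ [])     [-]     = []
  Linked-++⁻ʳ (x ∷ [])     (_ ∷ l) = l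
  Linked-++⁻ʳ (x ∷ y ∷ xs) (_ ∷ l) = Linked-++⁻ʳ (y ∷ xs) l

  head-++-∷ : ∀ (xs : List A) {y ys zs} → head (xs ++ y ∷ ys) ≡ head (xs ++ y ∷ zs)
  head-++-∷ []       = refl
  head-++-∷ (x ∷ xs) = refl

  last-++-∷ : ∀ (xs : List A) {y ys} → last (xs ++ y ∷ ys) ≡ last (y ∷ ys)
  last-++-∷ []           = refl
  last-++-∷ (x ∷ [])     = refl
  last-++-∷ (x ∷ y ∷ xs) = last-++-∷ (y ∷ xs)

  ∈-bypass⁻ : ∀ (xs : List A) {u v ms ys x} → x ∈ xs ++ u ∷ v ∷ ys → x ≡ v ⊎ x ∈ xs ++ u ∷ ms ++ ys
  ∈-bypass⁻ []       (here refl)         = inj₂ (here refl)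
  ∈-bypass⁻ []       (there (here refl)) = inj₁ refl
  ∈-bypass⁻ []  {ms = ms} (there (there x∈)) = inj₂ (there (∈-++⁺ʳ ms x∈))
  ∈-bypass⁻ (x ∷ xs) (here refl)         = inj₂ (here refl)
  ∈-bypass⁻ (x ∷ xs) (there x∈)          = map₂ there (∈-bypass⁻ xs x∈)

  Unique-bypass : ∀ (xs : List A) {u v ms ys} → Unique (xs ++ u ∷ ms ++ ys) → v ∉ xs ++ u ∷ ms ++ ys →
                  Unique (xs ++ u ∷ v ∷ ys)
  Unique-bypass [] {u} {v} {ms} {ys} (u∉ ∷ uniq) v∉ =
    (u≢v ∷ ++⁻ʳ ms u∉) ∷ All.tabulate v≢ ∷ Unique-++⁻ʳ ms uniq
    where
    u≢v : u ≢ v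
    u≢v refl = v∉ (here refl)
    v≢ : ∀ {y} → y ∈ ys → v ≢ y
    v≢ y∈ refl = v∉ (there (∈-++⁺ʳ ms y∈))
  Unique-bypass (x ∷ xs) {u} {v} {ms} {ys} (x∉ ∷ uniq) v∉ =
    All.tabulate x≢ ∷ Unique-bypass xs uniq (v∉ ∘ there)
    where
    x≢ : ∀ {y} → y ∈ xs ++ u ∷ v ∷ ys → x ≢ y
    x≢ y∈ with ∈-bypass⁻ xs {ms = ms} y∈
    ... | inj₁ refl = λ { refl → v∉ (here refl) }
    ... | inj₂ y∈′  = All.lookup x∉ y∈′

  Linked-bypass : ∀ {r} {R : Rel A r} (xs : List A) {u v w ms ys} → Linked R (xs ++ u ∷ ms ++ w ∷ ys) →
                  R u v → R v w → Linked R (xs ++ u ∷ v ∷ w ∷ ys)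
  Linked-bypass []           {ms = ms} l     Ruv Rvw = Ruv ∷ Rvw ∷ Linked-++⁻ʳ (_ ∷ ms) l
  Linked-bypass (x ∷ [])     (Rxu ∷ l) Ruv Rvw = Rxu ∷ Linked-bypass [] l Ruv Rvw
  Linked-bypass (x ∷ y ∷ xs) (Rxy ∷ l) Ruv Rvw = Rxy ∷ Linked-bypass (y ∷ xs) l Ruv Rvw

  length-bypass-< : ∀ (xs : List A) {u v w ms ys} → 2 ≤ length ms →
                    length (xs ++ u ∷ v ∷ w ∷ ys) < length (xs ++ u ∷ ms ++ w ∷ ys)
  length-bypass-< []       {ms = ms} {ys} 2≤ms =
    s≤s (subst (3 + length ys ≤_) (sym (length-++ ms)) (+-monoˡ-≤ (suc (length ys)) 2≤ms))
  length-bypass-< (x ∷ xs) 2≤ms = s≤s (length-bypass-< xs 2≤ms)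

sum-map-< : ∀ {A : Set} (xs : List A) {f g : A → ℕ} → (∀ x → f x ≤ g x) →
            ∀ {y} → y ∈ xs → f y < g y → sum (map f xs) < sum (map g xs)
sum-map-< (x ∷ xs) {f} {g} f≤g (here refl) fx<gx = +-mono-<-≤ fx<gx (sum-map-≤ xs)
  where
  sum-map-≤ : ∀ xs → sum (map f xs) ≤ sum (map g xs)
  sum-map-≤ []       = z≤n
  sum-map-≤ (x ∷ xs) = +-mono-≤ (f≤g x) (sum-map-≤ xs)
sum-map-< (x ∷ xs) f≤g (there y∈) fy<gy = +-mono-≤-< (f≤g x) (sum-map-< xs f≤g y∈ fy<gy)

module _ (G : Digraph) where

  IsPathFromTo-bypass : ∀ {s t} xs {u v w ms ys} → IsPathFromTo G s t (xs ++ u ∷ ms ++ w ∷ ys) →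
                        v ∉ xs ++ u ∷ ms ++ w ∷ ys → E G u v → E G v w →
                        IsPathFromTo G s t (xs ++ u ∷ v ∷ w ∷ ys)
  IsPathFromTo-bypass {t = t} xs {u} {v} {w} {ms} {ys} ((_ , unique , linked) , head≡s , last≡t) v∉ Euv Evw =
    (nonempty , Unique-bypass xs unique v∉ , Linked-bypass xs linked Euv Evw) ,
    trans (head-++-∷ xs) head≡s , last≡t′
    where
    nonempty : xs ++ u ∷ v ∷ w ∷ ys ≢ []
    nonempty eq with ++-conicalʳ xs _ eq
    ... | ()
    open ≡-Reasoning
    last≡t′ : last (xs ++ u ∷ v ∷ w ∷ ys) ≡ just t
    last≡t′ = begin
      last (xs ++ u ∷ v ∷ w ∷ ys)   ≡⟨ last-++-∷ xs ⟩
      last (w ∷ ys)                 ≡⟨ sym (last-++-∷ (u ∷ ms)) ⟩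
      last (u ∷ ms ++ w ∷ ys)       ≡⟨ sym (last-++-∷ xs) ⟩
      last (xs ++ u ∷ ms ++ w ∷ ys) ≡⟨ last≡t ⟩
      just t                        ∎

module _ {m : ℕ} (C : Subset m) where

  ∈-lastInC-++⁻ : ∀ {ℓ x} (xs ys zs : List (Fin m)) → ℓ ≤ length (inC C ys) →
                  x ∈ lastInC ℓ C (xs ++ ys ++ zs) → x ∈ lastInC ℓ C ys ⊎ (x ∈ zs × x ∈ₛ C)
  ∈-lastInC-++⁻ {ℓ} {x} xs ys zs ℓ≤ x∈ =
    map₂ (∈-filter⁻ (_∈? C))
         (∈-lastN-++⁻ (inC C xs) (inC C ys) (inC C zs) ℓ≤ (subst (λ L → x ∈ lastN ℓ L) inC-++ x∈))
    where
    inC-++ : inC C (xs ++ ys ++ zs) ≡ inC C xs ++ inC C ys ++ inC C zs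
    inC-++ = trans (filter-++ (_∈? C) xs (ys ++ zs)) (cong (inC C xs ++_) (filter-++ (_∈? C) ys zs))

  lastInC-split : ∀ {ℓ d} (Q : List (Fin m)) → suc d ≤ ℓ → ℓ ≤ length (inC C Q) →
                  Σ (Fin m) λ u → Σ (List (Fin m)) λ Q₁ → Σ (List (Fin m)) λ Q₂ →
                  u ∈ lastInC ℓ C Q × Q ≡ Q₁ ++ u ∷ Q₂ × d ≤ length Q₂
  lastInC-split {ℓ} {d} Q d<ℓ ℓ≤ = split (lastInC ℓ C Q) refl (length-lastN (inC C Q) ℓ≤)
    where
    split : ∀ L → lastInC ℓ C Q ≡ L → length L ≡ ℓ →
            Σ (Fin m) λ u → Σ (List (Fin m)) λ Q₁ → Σ (List (Fin m)) λ Q₂ →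
            u ∈ L × Q ≡ Q₁ ++ u ∷ Q₂ × d ≤ length Q₂
    split []      _  len with subst (suc d ≤_) (sym len) d<ℓ
    ... | ()
    split (u ∷ r) eq len with drop-filter-split (_∈? C) (length (inC C Q) ∸ ℓ) Q eq
    ... | Q₁ , Q₂ , Q≡ , r≤Q₂ = u , Q₁ , Q₂ , here refl , Q≡ , ≤-trans (s≤s⁻¹ (subst (suc d ≤_) (sym len) d<ℓ)) r≤Q₂

private
  ++-regroup : ∀ {A : Set} (a b c d e f g : List A) →
               a ++ (b ++ c ++ d) ++ e ++ f ++ g ≡ (a ++ b) ++ c ++ (d ++ e) ++ f ++ g
  ++-regroup {A} a b c d e f g = solve (++-monoid A)

  ++-reassoc : ∀ {A : Set} (a b c d e : List A) → a ++ (b ++ c ++ d) ++ e ≡ (a ++ b) ++ c ++ d ++ e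
  ++-reassoc {A} a b c d e = solve (++-monoid A)

module Rerouting (G : Digraph) (k : ℕ) (s t : Fin k → Vertex G) (P : Fin k → List (Vertex G)) where

  private
    updateAt-cases : ∀ i (N : List (Vertex G)) j →
                     (j ≡ i × updateAt P i (const N) j ≡ N) ⊎ (j ≢ i × updateAt P i (const N) j ≡ P j)
    updateAt-cases i N j with j ≟ i
    ... | yes refl = inj₁ (refl , updateAt-updates i P)
    ... | no j≢i   = inj₂ (j≢i , updateAt-minimal j i P j≢i)

  LinkageFor-updateAt : LinkageFor G k s t P → ∀ i {N} → IsPathFromTo G (s i) (t i) N →
                        (∀ j → j ≢ i → ∀ {x} → x ∈ N → x ∉ P j) →
                        LinkageFor G k s t (updateAt P i (const N))
  LinkageFor-updateAt ((_ , disjoint) , paths) i {N} pathN N-avoids =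
    ((λ j → proj₁ (paths′ j)) , disjoint′) , paths′
    where
    paths′ : ∀ j → IsPathFromTo G (s j) (t j) (updateAt P i (const N) j)
    paths′ j with updateAt-cases i N j
    ... | inj₁ (refl , eq) = subst (IsPathFromTo G (s i) (t i)) (sym eq) pathN
    ... | inj₂ (_ , eq)    = subst (IsPathFromTo G (s j) (t j)) (sym eq) (paths j)
    disjoint′ : ∀ j j′ → j ≢ j′ → ∀ x → x ∈ updateAt P i (const N) j → x ∉ updateAt P i (const N) j′
    disjoint′ j j′ j≢j′ x x∈ x∈′ with updateAt-cases i N j | updateAt-cases i N j′
    ... | inj₁ (refl , _)  | inj₁ (refl , _)  = j≢j′ refl
    ... | inj₁ (refl , eq) | inj₂ (j′≢i , eq′) = N-avoids j′ j′≢i (subst (x ∈_) eq x∈) (subst (x ∈_) eq′ x∈′)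
    ... | inj₂ (j≢i , eq)  | inj₁ (refl , eq′) = N-avoids j j≢i (subst (x ∈_) eq′ x∈′) (subst (x ∈_) eq x∈)
    ... | inj₂ (_ , eq)    | inj₂ (_ , eq′)    = disjoint j j′ j≢j′ x (subst (x ∈_) eq x∈) (subst (x ∈_) eq′ x∈′)

  size-updateAt-< : ∀ i {N} → length N < length (P i) → size (updateAt P i (const N)) < size P
  size-updateAt-< i {N} N<Pi = sum-map-< (allFin k) shrinks (∈-allFin i)
    (subst (_< length (P i)) (cong length (sym (updateAt-updates i P))) N<Pi)
    where
    shrinks : ∀ j → length (updateAt P i (const N) j) ≤ length (P j)
    shrinks j with updateAt-cases i N j
    ... | inj₁ (refl , eq) = subst (_≤ length (P i)) (cong length (sym eq)) (<⇒≤ N<Pi)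
    ... | inj₂ (_ , eq)    = ≤-reflexive (cong length eq)

  module _ (minimum : IsMinimumLinkageFor G k s t P) where

    private
      paths : ∀ i → IsPathFromTo G (s i) (t i) (P i)
      paths = proj₂ (proj₁ minimum)

      disjoint : ∀ i j → i ≢ j → ∀ x → x ∈ P i → x ∉ P j
      disjoint = proj₂ (proj₁ (proj₁ minimum))

    minimum-no-shorter-replacement : ∀ i {N} → IsPathFromTo G (s i) (t i) N →
                                     (∀ j → j ≢ i → ∀ {x} → x ∈ N → x ∉ P j) → ¬ length N < length (P i)
    minimum-no-shorter-replacement i pathN N-avoids N<Pi =
      <⇒≱ (size-updateAt-< i N<Pi) (proj₂ minimum _ (LinkageFor-updateAt (proj₁ minimum) i pathN N-avoids))

    minimum-no-bypass : ∀ i xs {u v w ms ys} →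
                        P i ≡ xs ++ u ∷ ms ++ w ∷ ys → 2 ≤ length ms → (∀ j → v ∉ P j) →
                        E G u v → E G v w → ⊥
    minimum-no-bypass i xs {u} {v} {w} {ms} {ys} Pi≡ 2≤ms v∉ Euv Evw =
      minimum-no-shorter-replacement i bypass avoids
        (subst (λ Pi → length (xs ++ u ∷ v ∷ w ∷ ys) < length Pi) (sym Pi≡) (length-bypass-< xs 2≤ms))
      where
      bypass : IsPathFromTo G (s i) (t i) (xs ++ u ∷ v ∷ w ∷ ys)
      bypass = IsPathFromTo-bypass G xs (subst (IsPathFromTo G (s i) (t i)) Pi≡ (paths i))
                                        (subst (v ∉_) Pi≡ (v∉ i)) Euv Evw
      avoids : ∀ j → j ≢ i → ∀ {x} → x ∈ xs ++ u ∷ v ∷ w ∷ ys → x ∉ P j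
      avoids j j≢i x∈ with ∈-bypass⁻ xs {ms = ms} x∈
      ... | inj₁ refl = v∉ j
      ... | inj₂ x∈Pi = disjoint i j (j≢i ∘ sym) _ (subst (_ ∈_) (sym Pi≡) x∈Pi)

    minimum-no-edge-past-lastInC : ∀ {ℓ} → 3 ≤ ℓ → (C : Subset (n G)) →
                                   ∀ i xs Q ys → P i ≡ xs ++ Q ++ ys → ℓ ≤ length (inC C Q) →
                                   ∀ {v} → (∀ j → v ∉ P j) → All (λ u → E G u v) (lastInC ℓ C Q) →
                                   ∀ {w} → w ∈ ys → ¬ E G v w
    minimum-no-edge-past-lastInC 3≤ℓ C i xs Q ys Pi≡ ℓ≤ v∉ Q→v {w} w∈ Evw
      with lastInC-split C Q 3≤ℓ ℓ≤ | ∈-∃++ w∈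
    ... | u , Q₁ , Q₂ , u∈ , refl , 2≤Q₂ | ys₁ , ys₂ , refl =
      minimum-no-bypass i (xs ++ Q₁) {ms = Q₂ ++ ys₁} (trans Pi≡ (++-regroup xs Q₁ (u ∷ []) Q₂ ys₁ (w ∷ []) ys₂))
        (≤-trans 2≤Q₂ (subst (length Q₂ ≤_) (sym (length-++ Q₂)) (m≤m+n _ _))) v∉ (All.lookup Q→v u∈) Evw

mainTheorem5 : (G : Digraph) (k : ℕ) (s t : Fin k → Vertex G) (P : Fin k → List (Vertex G))
    → AllDistinct s t
    → IsMinimumLinkageFor G k s t P
    → (ℓ : ℕ) → 3 ≤ ℓ
    → (C : Subset (n G)) → IsClique G C
    → (Q′ Q : List (Vertex G))
    → Σ (Fin k) (λ i → IsSubpath Q′ (P i))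
    → IsSubpath Q Q′
    → ℓ ≤ length (inC C Q)
    → (v : Vertex G) → v ∈ₛ C → (∀ i → v ∉ P i)
    → All (λ u → E G u v) (lastInC ℓ C Q)
    → All (λ u → E G u v) (lastInC ℓ C Q′)
mainTheorem5 G k s t P _ minimum ℓ 3≤ℓ C clique Q′ Q (i , pre , suf , Pi≡) (pre′ , suf′ , refl) ℓ≤ v v∈C v∉ Q→v =
  All.tabulate edge
  where
  open Rerouting G k s t P
  Pi≡′ : P i ≡ (pre ++ pre′) ++ Q ++ suf′ ++ suf
  Pi≡′ = trans Pi≡ (++-reassoc pre pre′ Q suf′ suf)
  edge : ∀ {w} → w ∈ lastInC ℓ C (pre′ ++ Q ++ suf′) → E G w v
  edge {w} w∈ with ∈-lastInC-++⁻ C pre′ Q suf′ ℓ≤ w∈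
  ... | inj₁ w∈Q = All.lookup Q→v w∈Q
  ... | inj₂ (w∈suf′ , w∈C) with clique w v w∈C v∈C w≢v
    where
    w≢v : w ≢ v
    w≢v refl = v∉ i (subst (w ∈_) (sym Pi≡′) (∈-++⁺ʳ (pre ++ pre′) (∈-++⁺ʳ Q (∈-++⁺ˡ w∈suf′))))
  ...   | inj₁ Ewv = Ewv
  ...   | inj₂ Evw =
    ⊥-elim (minimum-no-edge-past-lastInC minimum 3≤ℓ C i (pre ++ pre′) Q (suf′ ++ suf) Pi≡′ ℓ≤ v∉ Q→v (∈-++⁺ˡ w∈suf′) Evw)
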